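{- Let $\bowtie\in\{\preceq_{\mathrm{pred}},\succeq_{\mathrm{pred}}\}$, $\mathcal{T}\in\{\mathrm{dwp},\mathrm{awp}\}$, let $C$ be a pGCL program and $f$ an expectation. Then $\mathrm{trans}^{\bowtie}_{\mathcal{T}}[\![C]\!](f)\multimap C$.
   Context: States: fix a countably infinite set $\mathsf{Vars}$ of variables with values in $\mathbb{Q}_{\ge 0}$; $\mathsf{States}$ is the set of maps $\sigma:\mathsf{Vars}\to\mathbb{Q}_{\ge0}$ that are $0$ for all but finitely many variables. A predicate is a map $\mathsf{States}\to\{\mathsf{true},\mathsf{false}\}$; $\sigma\models\varphi$, validity $\models\varphi$, and entailment $\varphi\models\psi$ are as usual; $\varphi\Rightarrow\psi$ is pointwise implication. pGCL programs: $\mathtt{skip}$; $x:=E$ ($E:\mathsf{States}\to\mathbb{Q}_{\ge0}$); $C_1;C_2$; guarded choice $\mathtt{if}\ \varphi_1\to C_1\ \square\ \varphi_2\to C_2$ with $\varphi_1\vee\varphi_2$ valid; probabilistic choice $\{C_1\}[p]\{C_2\}$ with $p:\mathsf{States}\to[0,1]$; loops $\mathtt{while}_I(\varphi)\{C\}$ annotated with an invariant expectation $I$. Expectations: maps $\mathsf{States}\to[0,\infty]$ with pointwise order; pointwise arithmetic ($0\cdot\infty=0$), $\sqcap$/$\sqcup$ pointwise min/max; $[\varphi]$ Iverson bracket; $(\varphi\to g)(\sigma)=g(\sigma)$ if $\sigma\models\varphi$ else $\infty$; $f[x/E](\sigma)=f(\sigma[x\mapsto E(\sigma)])$. For expectations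 $f,g$, $f\preceq_{\mathrm{pred}} g$ is the predicate true at $\sigma$ iff $f(\sigma)\le g(\sigma)$, and $f\succeq_{\mathrm{pred}} g$ the predicate true iff $f(\sigma)\ge g(\sigma)$. Auxiliary transformers $\mathcal{T}^*$ for $\mathcal{T}\in\{\mathrm{dwp},\mathrm{awp}\}$: $\mathcal{T}^*[\![\mathtt{skip}]\!](f)=f$; $\mathcal{T}^*[\![x:=E]\!](f)=f[x/E]$; $\mathcal{T}^*[\![C_1;C_2]\!](f)=\mathcal{T}^*[\![C_1]\!](\mathcal{T}^*[\![C_2]\!](f))$; $\mathcal{T}^*[\![\{C_1\}[p]\{C_2\}]\!](f)=p\cdot\mathcal{T}^*[\![C_1]\!](f)+(1-p)\cdot\mathcal{T}^*[\![C_2]\!](f)$; $\mathrm{dwp}^*$ of a guarded choice is $(\varphi_1\to\mathrm{dwp}^*[\![C_1]\!](f))\sqcap(\varphi_2\to\mathrm{dwp}^*[\![C_2]\!](f))$ and $\mathrm{awp}^*$ of it is $[\varphi_1]\cdot\mathrm{awp}^*[\![C_1]\!](f)\sqcup[\varphi_2]\cdot\mathrm{awp}^*[\![C_2]\!](f)$; and $\mathcal{T}^*[\![\mathtt{while}_I(\varphi)\{C'\}]\!](f)=I$. Program transformer $\mathrm{trans}^{\bowtie}_{\mathcal{T}}[\![C]\!](f)$, by induction on $C$: $\mathtt{skip}\mapsto\mathtt{skip}$; $x:=E\mapsto x:=E$; $C_1;C_2\mapsto \mathrm{trans}^{\bowtie}_{\mathcal{T}}[\![C_1]\!](\mathcal{T}^*[\![C_2]\!](f));\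 \mathrm{trans}^{\bowtie}_{\mathcal{T}}[\![C_2]\!](f)$; $\mathtt{if}\ \varphi_1\to C_1\ \square\ \varphi_2\to C_2\mapsto \mathtt{if}\ \varphi_1\wedge(\varphi_2\Rightarrow \mathcal{T}^*[\![C_1]\!](f)\bowtie\mathcal{T}^*[\![C_2]\!](f))\to\mathrm{trans}^{\bowtie}_{\mathcal{T}}[\![C_1]\!](f)\ \square\ \varphi_2\wedge(\varphi_1\Rightarrow\mathcal{T}^*[\![C_2]\!](f)\bowtie\mathcal{T}^*[\![C_1]\!](f))\to\mathrm{trans}^{\bowtie}_{\mathcal{T}}[\![C_2]\!](f)$; $\{C_1\}[p]\{C_2\}\mapsto\{\mathrm{trans}^{\bowtie}_{\mathcal{T}}[\![C_1]\!](f)\}[p]\{\mathrm{trans}^{\bowtie}_{\mathcal{T}}[\![C_2]\!](f)\}$; $\mathtt{while}_I(\varphi)\{C'\}\mapsto\mathtt{while}_I(\varphi)\{\mathrm{trans}^{\bowtie}_{\mathcal{T}}[\![C']\!](I)\}$. Implementation relation $\multimap$: the smallest partial order on pGCL such that: $C_1'\multimap C_1$, $C_2'\multimap C_2$ imply $C_1';C_2'\multimap C_1;C_2$ and $\{C_1'\}[p]\{C_2'\}\multimap\{C_1\}[p]\{C_2\}$; $C'\multimap C$ implies $\mathtt{while}_I(\varphi)\{C'\}\multimap\mathtt{while}_I(\varphi)\{C\}$ (same guard and invariant annotation); and if $\varphi_i'\models\varphi_i$ ($i=1,2$), $\models\varphi_1'\vee\varphi_2'$, $C_i'\multimap C_i$,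 then $\mathtt{if}\ \varphi_1'\to C_1'\ \square\ \varphi_2'\to C_2'\multimap\mathtt{if}\ \varphi_1\to C_1\ \square\ \varphi_2\to C_2$. -}

module Defs where

open import Level using (0ℓ)
open import Data.Bool using (Bool; true; false; if_then_else_; _∧_; _∨_; not)
open import Data.Nat as ℕ using (ℕ; suc; _≡ᵇ_)
import Data.Nat.Properties as ℕP
open import Data.Rational as ℚ using (ℚ; 0ℚ)
open import Data.Product using (Σ; ∃; _,_; proj₁; proj₂)
open import Relation.Binary.PropositionalEquality using (_≡_; refl)
open import Relation.Binary.Structures using (IsDecTotalOrder)
open import Relation.Nullary.Decidable using (isYes)
open import Data.Sum using (_⊎_)

Vars : Set
Vars = ℕ

ℚ≥0 : Set
ℚ≥0 = Σ ℚ (λ q → 0ℚ ℚ.≤ q)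

0ℚ≥0 : ℚ≥0
0ℚ≥0 = 0ℚ , ℚ.*≤* (Data.Integer.+≤+ ℕ.z≤n)
  where import Data.Integer

record States : Set where
  constructor state
  field
    val     : Vars → ℚ≥0
    finite  : ∃ λ n → ∀ m → n ℕ.≤ m → proj₁ (val m) ≡ 0ℚ
open States public

private
  upd-val : (Vars → ℚ≥0) → Vars → ℚ≥0 → Vars → ℚ≥0
  upd-val s x v m = if m ≡ᵇ x then v else s m

  upd-fin : (σ : States) (x : Vars) (v : ℚ≥0) →
            ∃ λ n → ∀ m → n ℕ.≤ m → proj₁ (upd-val (val σ) x v m) ≡ 0ℚ
  upd-fin σ x v with finite σ
  ... | n , h = suc x ℕ.⊔ n , λ m le → go m le
    where
    go : ∀ m → suc x ℕ.⊔ n ℕ.≤ m → proj₁ (upd-val (val σ) x v m) ≡ 0ℚ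
    go m le with m ≡ᵇ x in eq
    ... | true  = Relation.Nullary.contradiction
                    (ℕP.≤-trans (ℕP.m≤m⊔n (suc x) n) le)
                    (λ sx≤m → ℕP.<-irrefl (Relation.Binary.PropositionalEquality.sym (ℕP.≡ᵇ⇒≡ m x (Relation.Binary.PropositionalEquality.subst Data.Bool.T (Relation.Binary.PropositionalEquality.sym eq) _))) sx≤m)
      where import Relation.Nullary; import Data.Bool
            import Relation.Binary.PropositionalEquality
    ... | false = h m (ℕP.≤-trans (ℕP.m≤n⊔m (suc x) n) le)

_[_↦_] : States → Vars → ℚ≥0 → States
σ [ x ↦ v ] = state (upd-val (val σ) x v) (upd-fin σ x v)

Pred : Set
Pred = States → Bool

_⊨_ : States → Pred → Set
σ ⊨ φ = φ σ ≡ true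

⊨_ : Pred → Set
⊨ φ = ∀ σ → σ ⊨ φ

_⊨ᵉ_ : Pred → Pred → Set
φ ⊨ᵉ ψ = ∀ σ → σ ⊨ φ → σ ⊨ ψ

_∧ᵖ_ _∨ᵖ_ _⇒ᵖ_ : Pred → Pred → Pred
(φ ∧ᵖ ψ) σ = φ σ ∧ ψ σ
(φ ∨ᵖ ψ) σ = φ σ ∨ ψ σ
(φ ⇒ᵖ ψ) σ = not (φ σ) ∨ ψ σ

-- Agda has no real numbers, so the extended non-negative reals are
-- abstracted as a structure carrying a decidable total order and the
-- operations used by the transformers.

record ValueDomain : Set₁ where
  field
    V               : Set
    _≤_             : V → V → Set
    isDecTotalOrder : IsDecTotalOrder _≡_ _≤_
    𝟘 𝟙 ∞           : V
    _+_ _·_ _-_     : V → V → V   -- _-_ : truncated subtraction (for 1 - p)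
    _⊓_ _⊔_         : V → V → V
  open IsDecTotalOrder isDecTotalOrder public using (_≤?_)

module _ (D : ValueDomain) where
  open ValueDomain D

  Exp : Set
  Exp = States → V

  _+ᵉ_ _·ᵉ_ _⊓ᵉ_ _⊔ᵉ_ : Exp → Exp → Exp
  (f +ᵉ g) σ = f σ + g σ
  (f ·ᵉ g) σ = f σ · g σ
  (f ⊓ᵉ g) σ = f σ ⊓ g σ
  (f ⊔ᵉ g) σ = f σ ⊔ g σ

  1-ᵉ_ : Exp → Exp
  (1-ᵉ p) σ = 𝟙 - p σ

  [_] : Pred → Exp
  [ φ ] σ = if φ σ then 𝟙 else 𝟘

  _↪_ : Pred → Exp → Exp
  (φ ↪ g) σ = if φ σ then g σ else ∞

  _[_/_] : Exp → Vars → (States → ℚ≥0) → Exp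
  (f [ x / E ]) σ = f (σ [ x ↦ E σ ])

  _⪯pred_ _⪰pred_ : Exp → Exp → Pred
  (f ⪯pred g) σ = isYes (f σ ≤? g σ)
  (f ⪰pred g) σ = isYes (g σ ≤? f σ)

  data Prog : Set where
    skip   : Prog
    _≔_    : Vars → (States → ℚ≥0) → Prog
    _︔_    : Prog → Prog → Prog
    if_⟶_□_⟶_ : Pred → Prog → Pred → Prog → Prog
    ｛_｝[_]｛_｝ : Prog → Exp → Prog → Prog
    while[_]_｛_｝ : Exp → Pred → Prog → Prog

  data WF : Prog → Set where
    wf-skip  : WF skip
    wf-asgn  : ∀ {x E} → WF (x ≔ E)
    wf-seq   : ∀ {C₁ C₂} → WF C₁ → WF C₂ → WF (C₁ ︔ C₂)
    wf-if    : ∀ {φ₁ C₁ φ₂ C₂} → ⊨ (φ₁ ∨ᵖ φ₂) → WF C₁ → WF C₂ →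
               WF (if φ₁ ⟶ C₁ □ φ₂ ⟶ C₂)
    wf-prob  : ∀ {C₁ p C₂} → (∀ σ → (𝟘 ≤ p σ) Data.Product.× (p σ ≤ 𝟙)) →
               WF C₁ → WF C₂ → WF ｛ C₁ ｝[ p ]｛ C₂ ｝
    wf-while : ∀ {I φ C} → WF C → WF (while[ I ] φ ｛ C ｝)

  data Transformer : Set where
    dwp awp : Transformer

  data Cmp : Set where
    ⪯ ⪰ : Cmp

  cmp : Cmp → Exp → Exp → Pred
  cmp ⪯ = _⪯pred_
  cmp ⪰ = _⪰pred_

  _* : Transformer → Prog → Exp → Exp
  (T *) skip f = f
  (T *) (x ≔ E) f = f [ x / E ]
  (T *) (C₁ ︔ C₂) f = (T *) C₁ ((T *) C₂ f)
  (T *) ｛ C₁ ｝[ p ]｛ C₂ ｝ f = (p ·ᵉ (T *) C₁ f) +ᵉ ((1-ᵉ p) ·ᵉ (T *) C₂ f)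
  (dwp *) (if φ₁ ⟶ C₁ □ φ₂ ⟶ C₂) f =
    (φ₁ ↪ (dwp *) C₁ f) ⊓ᵉ (φ₂ ↪ (dwp *) C₂ f)
  (awp *) (if φ₁ ⟶ C₁ □ φ₂ ⟶ C₂) f =
    ([ φ₁ ] ·ᵉ (awp *) C₁ f) ⊔ᵉ ([ φ₂ ] ·ᵉ (awp *) C₂ f)
  (T *) (while[ I ] φ ｛ C ｝) f = I

  trans : Cmp → Transformer → Prog → Exp → Prog
  trans ⋈ T skip f = skip
  trans ⋈ T (x ≔ E) f = x ≔ E
  trans ⋈ T (C₁ ︔ C₂) f = trans ⋈ T C₁ ((T *) C₂ f) ︔ trans ⋈ T C₂ f
  trans ⋈ T (if φ₁ ⟶ C₁ □ φ₂ ⟶ C₂) f =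
    if φ₁ ∧ᵖ (φ₂ ⇒ᵖ cmp ⋈ ((T *) C₁ f) ((T *) C₂ f)) ⟶ trans ⋈ T C₁ f
    □ φ₂ ∧ᵖ (φ₁ ⇒ᵖ cmp ⋈ ((T *) C₂ f) ((T *) C₁ f)) ⟶ trans ⋈ T C₂ f
  trans ⋈ T ｛ C₁ ｝[ p ]｛ C₂ ｝ f = ｛ trans ⋈ T C₁ f ｝[ p ]｛ trans ⋈ T C₂ f ｝
  trans ⋈ T (while[ I ] φ ｛ C ｝) f = while[ I ] φ ｛ trans ⋈ T C I ｝

  infix 4 _⊸_
  data _⊸_ : Prog → Prog → Set where
    ⊸-refl  : ∀ {C} → C ⊸ C
    ⊸-trans : ∀ {C C′ C″} → C ⊸ C′ → C′ ⊸ C″ → C ⊸ C″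
    ⊸-seq   : ∀ {C₁ C₁′ C₂ C₂′} → C₁′ ⊸ C₁ → C₂′ ⊸ C₂ → (C₁′ ︔ C₂′) ⊸ (C₁ ︔ C₂)
    ⊸-prob  : ∀ {C₁ C₁′ C₂ C₂′ p} → C₁′ ⊸ C₁ → C₂′ ⊸ C₂ →
              ｛ C₁′ ｝[ p ]｛ C₂′ ｝ ⊸ ｛ C₁ ｝[ p ]｛ C₂ ｝
    ⊸-while : ∀ {C C′ I φ} → C′ ⊸ C → while[ I ] φ ｛ C′ ｝ ⊸ while[ I ] φ ｛ C ｝
    ⊸-if    : ∀ {φ₁ φ₂ φ₁′ φ₂′ C₁ C₂ C₁′ C₂′} →
              φ₁′ ⊨ᵉ φ₁ → φ₂′ ⊨ᵉ φ₂ → ⊨ (φ₁′ ∨ᵖ φ₂′) →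
              C₁′ ⊸ C₁ → C₂′ ⊸ C₂ →
              (if φ₁′ ⟶ C₁′ □ φ₂′ ⟶ C₂′) ⊸ (if φ₁ ⟶ C₁ □ φ₂ ⟶ C₂)

-- The transformed program differs from C only in the guards of guarded
-- choices, which are strengthened by a comparison of the two branches'
-- auxiliary expectations. Strengthened guards entail the original ones, and
-- they still cover every state: where only one original guard holds its
-- refinement is vacuous, and where both hold the order on values is total,
-- so one of the two comparisons succeeds.
module Submission where

open import Defs
open import Data.Bool using (Bool; true; false; _∧_; _∨_; not)
open import Data.Bool.Properties using (∨-zeroʳ; ∧-conicalˡ)
open import Data.Sum using (inj₁; inj₂)
open import Relation.Nullary.Decidable using (isYes; isYes≗does; dec-true)
open import Relation.Binary.PropositionalEquality using (_≡_; refl) renaming (trans to ≡-trans)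
open import Relation.Binary.Structures using (IsDecTotalOrder)

module _ (D : ValueDomain) where
  open ValueDomain D
  open IsDecTotalOrder isDecTotalOrder using (total)

  isYes-≤? : ∀ {a b} → a ≤ b → isYes (a ≤? b) ≡ true
  isYes-≤? {a} {b} a≤b = ≡-trans (isYes≗does (a ≤? b)) (dec-true (a ≤? b) a≤b)

  isYes-≤?-total : ∀ a b → isYes (a ≤? b) ∨ isYes (b ≤? a) ≡ true
  isYes-≤?-total a b with total a b
  ... | inj₁ a≤b rewrite isYes-≤? a≤b = refl
  ... | inj₂ b≤a rewrite isYes-≤? b≤a = ∨-zeroʳ _

  cmp-total : ∀ ⋈ (f g : Exp D) σ → cmp D ⋈ f g σ ∨ cmp D ⋈ g f σ ≡ true
  cmp-total ⪯ f g σ = isYes-≤?-total (f σ) (g σ)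
  cmp-total ⪰ f g σ = isYes-≤?-total (g σ) (f σ)

  ∧ᵖ-entails-left : ∀ (φ ψ : Pred) → (φ ∧ᵖ ψ) ⊨ᵉ φ
  ∧ᵖ-entails-left φ ψ σ = ∧-conicalˡ (φ σ) (ψ σ)

  refined-guards-cover : ∀ (a b c d : Bool) → a ∨ b ≡ true → c ∨ d ≡ true →
                         (a ∧ (not b ∨ c)) ∨ (b ∧ (not a ∨ d)) ≡ true
  refined-guards-cover true  true  true  _     _  _  = refl
  refined-guards-cover true  true  false true  _  _  = refl
  refined-guards-cover true  true  false false _  ()
  refined-guards-cover true  false _     _     _  _  = refl
  refined-guards-cover false true  _     _     _  _  = refl
  refined-guards-cover false false _     _     () _

  trans-⊸ : (⋈ : Cmp D) (T : Transformer D) (C : Prog D) (f : Exp D) →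
            WF D C → _⊸_ D (trans D ⋈ T C f) C
  trans-⊸ ⋈ T skip f _ = ⊸-refl
  trans-⊸ ⋈ T (x ≔ E) f _ = ⊸-refl
  trans-⊸ ⋈ T (C₁ ︔ C₂) f (wf-seq w₁ w₂) =
    ⊸-seq (trans-⊸ ⋈ T C₁ ((_* D T) C₂ f) w₁) (trans-⊸ ⋈ T C₂ f w₂)
  trans-⊸ ⋈ T (if φ₁ ⟶ C₁ □ φ₂ ⟶ C₂) f (wf-if covers w₁ w₂) =
    ⊸-if (∧ᵖ-entails-left φ₁ _) (∧ᵖ-entails-left φ₂ _)
         (λ σ → refined-guards-cover (φ₁ σ) (φ₂ σ) _ _ (covers σ)
                  (cmp-total ⋈ ((_* D T) C₁ f) ((_* D T) C₂ f) σ))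
         (trans-⊸ ⋈ T C₁ f w₁) (trans-⊸ ⋈ T C₂ f w₂)
  trans-⊸ ⋈ T ｛ C₁ ｝[ p ]｛ C₂ ｝ f (wf-prob _ w₁ w₂) =
    ⊸-prob (trans-⊸ ⋈ T C₁ f w₁) (trans-⊸ ⋈ T C₂ f w₂)
  trans-⊸ ⋈ T (while[ I ] φ ｛ C ｝) f (wf-while w) = ⊸-while (trans-⊸ ⋈ T C I w)

theorem6p2 : (D : ValueDomain) (⋈ : Cmp D) (T : Transformer D) (C : Prog D) (f : Exp D) →
    WF D C → _⊸_ D (trans D ⋈ T C f) C
theorem6p2 = trans-⊸
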